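{- Let $G$ be a graph with $X\subseteq V(G)$ and let $l$ be an intersecting supermodular real function on subsets of $V(G)$. If $G[X]$ and $G/X$ are $l$-partition-connected, then $G$ is $l$-partition-connected.
   Context: Graphs are finite, loopless, and may have multiple edges. $l(\emptyset)=0$. $l$ is intersecting supermodular if $l(A\cap B)+l(A\cup B)\ge l(A)+l(B)$ whenever $A\cap B\neq\emptyset$. $G/X$ is obtained from $G$ by contracting $X$ into a single vertex $x$ (edges with both ends in $X$ are deleted); $l$ is evaluated on vertex sets of $G/X$ by replacing $x$ with $X$. For a partition $P$ of $V(K)$, $e_K(P)$ is the number of edges of $K$ joining different parts; $K$ is $l$-partition-connected if $e_K(P)\ge\sum_{A\in P}l(A)-l(V(K))$ for every partition $P$ of $V(K)$. -}

module Defs where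

open import Level using (0ℓ)
open import Data.Nat using (ℕ; zero; suc)
open import Data.Bool using (Bool; true; false; if_then_else_; not; _∧_)
open import Data.Fin using (Fin; zero; suc; fromℕ; inject₁)
open import Data.Fin.Properties using (_≟_)
open import Data.Fin.Subset using (Subset; _∈_; _∩_; _∪_; ∁; ⊤; ⊥; Nonempty)
open import Data.Fin.Subset.Properties using (_∈?_)
open import Data.Vec using (Vec; tabulate; lookup; _∷ʳ_)
open import Data.List using (List; length; filter; map)
open import Data.Product using (_×_; _,_; proj₁; proj₂; ∃)
open import Relation.Binary using (Rel; IsTotalOrder)
open import Relation.Binary.PropositionalEquality using (_≡_; _≢_)
open import Relation.Nullary using (¬_; Dec; yes; no)
open import Relation.Nullary.Decidable using (⌊_⌋; ¬?)
open import Algebra.Bundles using (CommutativeRing)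

-- Values of l: an arbitrary ordered commutative ring (ℝ is an instance).

record OrderedCommRing : Set₁ where
  field
    commRing : CommutativeRing 0ℓ 0ℓ
  open CommutativeRing commRing public hiding (zero)
  infix 4 _≤_
  field
    _≤_          : Rel Carrier 0ℓ
    isTotalOrder : IsTotalOrder _≈_ _≤_
    +-monoˡ-≤    : ∀ {x y} z → x ≤ y → x + z ≤ y + z
    *-nonneg     : ∀ {x y} → 0# ≤ x → 0# ≤ y → 0# ≤ x * y
    0≤1          : 0# ≤ 1#

  fromℕ' : ℕ → Carrier
  fromℕ' zero    = 0#
  fromℕ' (suc n) = 1# + fromℕ' n

  ∑ : ∀ {k} → (Fin k → Carrier) → Carrier
  ∑ {zero}  f = 0#
  ∑ {suc k} f = f zero + ∑ (λ i → f (suc i))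

-- Graphs: vertex set Fin n, edges a list of (ordered) pairs (multigraph).

Edge : ℕ → Set
Edge n = Fin n × Fin n

Loopless : ∀ {n} → List (Edge n) → Set
Loopless {n} E = ∀ (e : Edge n) → Data.List.Membership.Propositional._∈_ e E → proj₁ e ≢ proj₂ e
  where import Data.List.Membership.Propositional

module _ (R : OrderedCommRing) where
  open OrderedCommRing R

  IntersectingSupermodular : ∀ {n} → (Subset n → Carrier) → Set
  IntersectingSupermodular l =
    ∀ A B → Nonempty (A ∩ B) → l A + l B ≤ l (A ∩ B) + l (A ∪ B)

  -- A partition of a vertex set S ⊆ Fin m into k (nonempty) parts is given
  -- by a labelling p : Fin m → Fin k whose restriction to S is onto; the
  -- parts are S ∩ p⁻¹(i).  (Values of p outside S are irrelevant.)

  IsPartitionOf : ∀ {m k} → Subset m → (Fin m → Fin k) → Set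
  IsPartitionOf S p = ∀ i → ∃ λ v → v ∈ S × p v ≡ i

  part : ∀ {m k} → Subset m → (Fin m → Fin k) → Fin k → Subset m
  part S p i = S ∩ tabulate (λ v → ⌊ p v ≟ i ⌋)

  crossing : ∀ {m k} → List (Edge m) → (Fin m → Fin k) → ℕ
  crossing E p = length (filter (λ e → ¬? (p (proj₁ e) ≟ p (proj₂ e))) E)

  PartitionConnected : ∀ {m} → Subset m → List (Edge m) → (Subset m → Carrier) → Set
  PartitionConnected S E l =
    ∀ k (p : _ → Fin k) → IsPartitionOf S p →
      ∑ (λ i → l (part S p i)) - l S ≤ fromℕ' (crossing E p)

inside : ∀ {n} → Subset n → Edge n → Bool
inside X (u , v) = ⌊ u ∈? X ⌋ ∧ ⌊ v ∈? X ⌋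

inducedE : ∀ {n} → Subset n → List (Edge n) → List (Edge n)
inducedE X E = filter (λ e → Data.Bool._≟_ (inside X e) true) E
  where import Data.Bool

-- Contraction G/X on vertex type Fin (suc n): the new vertex x is fromℕ n,
-- a vertex v ∉ X is inject₁ v.  V(G/X) = (V(G) ∖ X) ∪ {x}.

contractVertex : ∀ {n} → Subset n → Fin n → Fin (suc n)
contractVertex {n} X v = if ⌊ v ∈? X ⌋ then fromℕ n else inject₁ v

contractV : ∀ {n} → Subset n → Subset (suc n)
contractV X = ∁ X ∷ʳ true

contractE : ∀ {n} → Subset n → List (Edge n) → List (Edge (suc n))
contractE X E =
  map (λ e → contractVertex X (proj₁ e) , contractVertex X (proj₂ e))
      (filter (λ e → Data.Bool._≟_ (inside X e) false) E)
  where import Data.Bool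

-- l on G/X: replace x by X
contractL : ∀ {n} {C : Set} → Subset n → (Subset n → C) → Subset (suc n) → C
contractL {n} X l A =
  l (tabulate (λ v → lookup A (inject₁ v)) ∪ (if lookup A (fromℕ n) then X else ⊥))

module Submission where

-- Let p label a partition {Aᵢ} of V(G). Merging X with all blocks that meet X
-- into one block M gives a partition of G/X (M is the block of the contracted
-- vertex, the blocks avoiding X stay), and the traces X ∩ Aᵢ partition G[X].
-- An edge crossing either of these partitions crosses p, and no edge of G is
-- counted twice, so e_G(p) ≥ e_G[X] + e_G/X. Adding the blocks that meet X to X
-- one at a time, intersecting supermodularity gives
--   l(X) + Σ_{Aᵢ ∩ X ≠ ∅} l(Aᵢ) ≤ Σᵢ l(X ∩ Aᵢ) + l(M),
-- and together with the partition inequalities of G[X] and G/X this bounds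
-- Σᵢ l(Aᵢ) − l(V) by e_G(p).

open import Defs
open import Level using (0ℓ)
open import Data.Nat as ℕ using (ℕ; zero; suc; z≤n; s≤s)
import Data.Nat.Properties as ℕ
open import Data.Bool using (Bool; true; false; if_then_else_)
open import Data.Bool.Properties using (T-≡)
open import Data.Fin using (Fin; zero; suc; fromℕ; inject₁; punchIn; punchOut)
open import Data.Fin.Properties
  using (_≟_; suc-injective; any?; all?; ¬∀⟶∃¬;
         punchInᵢ≢i; punchIn-punchOut; punchOut-punchIn; punchOut-cong)
open import Data.Fin.Subset using (Subset; _∈_; _∉_; _⊆_; _∩_; _∪_; ∁; ⊤; ⊥; ⋃; Nonempty)
open import Data.Fin.Subset.Properties
  using (_∈?_; nonempty?; Empty-unique; ∉⊥; ⊥⊆; ∈⊤; ⊆⊤; ⊆-antisym; x∈p∩q⁺; x∈p∩q⁻; x∈p∪q⁺; x∈p∪q⁻;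
         q⊆p∪q; x∈∁p⇒x∉p; x∉p⇒x∈∁p; ∩-zeroˡ; ∩-zeroʳ; ∩-distribʳ-∪; ∪-assoc; ∪-identityʳ)
open import Data.Vec using (Vec; []; _∷_; lookup; tabulate; _∷ʳ_)
open import Data.Vec.Properties using (lookup∘tabulate; tabulate-cong; []=⇒lookup; lookup⇒[]=)
open import Data.List using (List; []; _∷_)
import Data.List as List
open import Data.List.Relation.Binary.Sublist.Propositional using (⊆-refl)
open import Data.List.Relation.Binary.Sublist.Propositional.Properties using (filter⁺; length-mono-≤)
open import Data.Product as Product using (_×_; _,_; proj₁; proj₂; ∃; ∃₂)
open import Data.Sum using (_⊎_; inj₁; inj₂; [_,_]′)
open import Function using (_∘_; id)
open import Function.Bundles using (Equivalence)
open import Relation.Binary using (Poset; IsTotalOrder)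
open import Relation.Binary.PropositionalEquality as ≡ using (_≡_; _≢_; _≗_)
open import Relation.Nullary using (Dec; yes; no; ¬_; ¬?; contradiction; _×-dec_)
open import Relation.Nullary.Decidable using (⌊_⌋; toWitness; fromWitness)
import Relation.Binary.Reasoning.PartialOrder as PartialOrderReasoning
import Relation.Binary.Reasoning.Setoid as SetoidReasoning
import Algebra.Properties.AbelianGroup as AbelianGroupProperties
import Algebra.Properties.CommutativeMonoid.Sum as SumProperties
import Algebra.Solver.CommutativeMonoid as CommutativeMonoidSolver

module OrderedCommRingProperties (R : OrderedCommRing) where
  open OrderedCommRing R
  open SumProperties +-commutativeMonoid
    using (sum; sum-cong-≋; sum-remove; ∑-distrib-+; sum-replicate-zero)
  open CommutativeMonoidSolver +-commutativeMonoid using (solve; _⊜_; _⊕_)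
  open AbelianGroupProperties +-abelianGroup using (xyx⁻¹≈y)

  ≤-poset : Poset 0ℓ 0ℓ 0ℓ
  ≤-poset = record { isPartialOrder = IsTotalOrder.isPartialOrder isTotalOrder }

  open Poset ≤-poset public using () renaming (reflexive to ≤-reflexive; trans to ≤-trans)
  module ≤-Reasoning = PartialOrderReasoning ≤-poset
  module ≈-Reasoning = SetoidReasoning setoid

  +-monoʳ-≤ : ∀ {x y} z → x ≤ y → z + x ≤ z + y
  +-monoʳ-≤ {x} {y} z x≤y = begin
    z + x  ≈⟨ +-comm z x ⟩
    x + z  ≤⟨ +-monoˡ-≤ z x≤y ⟩
    y + z  ≈⟨ +-comm y z ⟩
    z + y  ∎
    where open ≤-Reasoning

  +-mono-≤ : ∀ {x y u v} → x ≤ y → u ≤ v → x + u ≤ y + v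
  +-mono-≤ {y = y} {u} x≤y u≤v = ≤-trans (+-monoˡ-≤ u x≤y) (+-monoʳ-≤ y u≤v)

  x+y≤z+w⇒y≤z-x+w : ∀ {x y z w} → x + y ≤ z + w → y ≤ (z - x) + w
  x+y≤z+w⇒y≤z-x+w {x} {y} {z} {w} x+y≤z+w = begin
    y                ≈⟨ xyx⁻¹≈y x y ⟨
    (x + y) - x      ≤⟨ +-monoˡ-≤ (- x) x+y≤z+w ⟩
    (z + w) - x      ≈⟨ solve 3 (λ z w -x → (z ⊕ w) ⊕ -x ⊜ (z ⊕ -x) ⊕ w) refl z w (- x) ⟩
    (z - x) + w      ∎
    where open ≤-Reasoning

  fromℕ'-homo-+ : ∀ a b → fromℕ' (a ℕ.+ b) ≈ fromℕ' a + fromℕ' b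
  fromℕ'-homo-+ zero    b = sym (+-identityˡ (fromℕ' b))
  fromℕ'-homo-+ (suc a) b = trans (+-congˡ (fromℕ'-homo-+ a b)) (sym (+-assoc 1# (fromℕ' a) (fromℕ' b)))

  fromℕ'-nonneg : ∀ a → 0# ≤ fromℕ' a
  fromℕ'-nonneg zero    = ≤-reflexive refl
  fromℕ'-nonneg (suc a) = ≤-trans (≤-reflexive (sym (+-identityʳ 0#))) (+-mono-≤ 0≤1 (fromℕ'-nonneg a))

  fromℕ'-mono-≤ : ∀ {a b} → a ℕ.≤ b → fromℕ' a ≤ fromℕ' b
  fromℕ'-mono-≤ {a} a≤b with ℕ.m≤n⇒∃[o]m+o≡n a≤b
  ... | d , ≡.refl = begin
    fromℕ' a               ≈⟨ +-identityʳ (fromℕ' a) ⟨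
    fromℕ' a + 0#          ≤⟨ +-monoʳ-≤ (fromℕ' a) (fromℕ'-nonneg d) ⟩
    fromℕ' a + fromℕ' d    ≈⟨ fromℕ'-homo-+ a d ⟨
    fromℕ' (a ℕ.+ d)       ∎
    where open ≤-Reasoning

  ≈-cong : ∀ {A : Set} (f : A → Carrier) {x y} → x ≡ y → f x ≈ f y
  ≈-cong f = reflexive ∘ ≡.cong f

  ∑≡sum : ∀ {k} (f : Fin k → Carrier) → ∑ f ≡ sum f
  ∑≡sum {zero}  f = ≡.refl
  ∑≡sum {suc k} f = ≡.cong (f zero +_) (∑≡sum (f ∘ suc))

  ∑-cong : ∀ {k} {f g : Fin k → Carrier} → (∀ i → f i ≈ g i) → ∑ f ≈ ∑ g
  ∑-cong {f = f} {g} f≈g rewrite ∑≡sum f | ∑≡sum g = sum-cong-≋ f≈g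

  ∑-zero : ∀ {k} {f : Fin k → Carrier} → (∀ i → f i ≈ 0#) → ∑ f ≈ 0#
  ∑-zero {k} {f} f≈0 rewrite ∑≡sum f = trans (sum-cong-≋ f≈0) (sum-replicate-zero k)

  ∑-remove : ∀ {k} (e : Fin (suc k)) (f : Fin (suc k) → Carrier) → ∑ f ≈ f e + ∑ (f ∘ punchIn e)
  ∑-remove e f rewrite ∑≡sum f | ∑≡sum (f ∘ punchIn e) = sum-remove {i = e} f

  ∑-+ : ∀ {k} (f g : Fin k → Carrier) → ∑ (λ i → f i + g i) ≈ ∑ f + ∑ g
  ∑-+ f g rewrite ∑≡sum (λ i → f i + g i) | ∑≡sum f | ∑≡sum g = ∑-distrib-+ f g

∈-tabulate⁺ : ∀ {n} {f : Fin n → Bool} {v} → f v ≡ true → v ∈ tabulate f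
∈-tabulate⁺ {f = f} {v} fv = lookup⇒[]= v (tabulate f) (≡.trans (lookup∘tabulate f v) fv)

∈-tabulate⁻ : ∀ {n} {f : Fin n → Bool} {v} → v ∈ tabulate f → f v ≡ true
∈-tabulate⁻ {f = f} {v} v∈ = ≡.trans (≡.sym (lookup∘tabulate f v)) ([]=⇒lookup v∈)

lookup-∷ʳ-inject₁ : ∀ {A : Set} {n} (xs : Vec A n) y i → lookup (xs ∷ʳ y) (inject₁ i) ≡ lookup xs i
lookup-∷ʳ-inject₁ (x ∷ xs) y zero    = ≡.refl
lookup-∷ʳ-inject₁ (x ∷ xs) y (suc i) = lookup-∷ʳ-inject₁ xs y i

lookup-∷ʳ-fromℕ : ∀ {A : Set} {n} (xs : Vec A n) y → lookup (xs ∷ʳ y) (fromℕ n) ≡ y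
lookup-∷ʳ-fromℕ []       y = ≡.refl
lookup-∷ʳ-fromℕ (x ∷ xs) y = lookup-∷ʳ-fromℕ xs y

∈-⋃-tabulate⁺ : ∀ {n k} (B : Fin k → Subset n) {i v} → v ∈ B i → v ∈ ⋃ (List.tabulate B)
∈-⋃-tabulate⁺ B {zero}  v∈Bi = x∈p∪q⁺ (inj₁ v∈Bi)
∈-⋃-tabulate⁺ B {suc i} v∈Bi = x∈p∪q⁺ (inj₂ (∈-⋃-tabulate⁺ (B ∘ suc) v∈Bi))

∈-⋃-tabulate⁻ : ∀ {n k} (B : Fin k → Subset n) {v} → v ∈ ⋃ (List.tabulate B) → ∃ λ i → v ∈ B i
∈-⋃-tabulate⁻ {k = zero}  B v∈ = contradiction v∈ ∉⊥
∈-⋃-tabulate⁻ {k = suc k} B v∈ with x∈p∪q⁻ (B zero) _ v∈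
... | inj₁ v∈B₀ = zero , v∈B₀
... | inj₂ v∈⋃  = Product.map suc id (∈-⋃-tabulate⁻ (B ∘ suc) v∈⋃)

disjoint⇒∩≡⊥ : ∀ {n} {A B : Subset n} → (∀ {v} → v ∈ A → v ∉ B) → A ∩ B ≡ ⊥
disjoint⇒∩≡⊥ {A = A} {B} disjoint =
  Empty-unique (λ (v , v∈A∩B) → let (v∈A , v∈B) = x∈p∩q⁻ A B v∈A∩B in disjoint v∈A v∈B)

-- contractL X l A unfolds to l (uncontract X A).
uncontract : ∀ {n} → Subset n → Subset (suc n) → Subset n
uncontract {n} X A = tabulate (λ v → lookup A (inject₁ v)) ∪ (if lookup A (fromℕ n) then X else ⊥)

module _ {n} {X : Subset n} where

  contractVertex-∈ : ∀ {v} → v ∈ X → contractVertex X v ≡ fromℕ n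
  contractVertex-∈ {v} v∈X with v ∈? X
  ... | yes _   = ≡.refl
  ... | no v∉X = contradiction v∈X v∉X

  contractVertex-∉ : ∀ {v} → v ∉ X → contractVertex X v ≡ inject₁ v
  contractVertex-∉ {v} v∉X with v ∈? X
  ... | yes v∈X = contradiction v∈X v∉X
  ... | no _    = ≡.refl

  inject₁-∈-contractV⁺ : ∀ {v} → v ∉ X → inject₁ v ∈ contractV X
  inject₁-∈-contractV⁺ {v} v∉X = lookup⇒[]= (inject₁ v) (contractV X)
    (≡.trans (lookup-∷ʳ-inject₁ (∁ X) true v) ([]=⇒lookup (x∉p⇒x∈∁p v∉X)))

  inject₁-∈-contractV⁻ : ∀ {v} → inject₁ v ∈ contractV X → v ∉ X
  inject₁-∈-contractV⁻ {v} v∈ = x∈∁p⇒x∉p (lookup⇒[]= v (∁ X)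
    (≡.trans (≡.sym (lookup-∷ʳ-inject₁ (∁ X) true v)) ([]=⇒lookup v∈)))

  contractVertex-∈-contractV : ∀ v → contractVertex X v ∈ contractV X
  contractVertex-∈-contractV v with v ∈? X
  ... | yes _   = lookup⇒[]= (fromℕ n) (contractV X) (lookup-∷ʳ-fromℕ (∁ X) true)
  ... | no v∉X = inject₁-∈-contractV⁺ v∉X

  ∈-uncontract⁺ : ∀ {A v} → contractVertex X v ∈ A → v ∈ uncontract X A
  ∈-uncontract⁺ {A} {v} cv∈A with v ∈? X
  ... | yes v∈X rewrite []=⇒lookup cv∈A = x∈p∪q⁺ (inj₂ v∈X)
  ... | no _    = x∈p∪q⁺ (inj₁ (∈-tabulate⁺ ([]=⇒lookup cv∈A)))

  ∈-uncontract⁻ : ∀ {A v} → A ⊆ contractV X → v ∈ uncontract X A → contractVertex X v ∈ A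
  ∈-uncontract⁻ {A} {v} A⊆ v∈ with x∈p∪q⁻ (tabulate (λ v → lookup A (inject₁ v))) _ v∈
  ... | inj₁ v∈A′ = ≡.subst (_∈ A) (≡.sym (contractVertex-∉ (inject₁-∈-contractV⁻ (A⊆ inj∈A)))) inj∈A
    where
    inj∈A : inject₁ v ∈ A
    inj∈A = lookup⇒[]= (inject₁ v) A (∈-tabulate⁻ v∈A′)
  ... | inj₂ v∈X with lookup A (fromℕ n) in last∈A
  ...   | true  = ≡.subst (_∈ A) (≡.sym (contractVertex-∈ v∈X)) (lookup⇒[]= (fromℕ n) A last∈A)
  ...   | false = contradiction v∈X ∉⊥

  uncontract-contractV : uncontract X (contractV X) ≡ ⊤
  uncontract-contractV = ⊆-antisym ⊆⊤ (λ {v} _ → ∈-uncontract⁺ (contractVertex-∈-contractV v))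

  uncontract-⊥ : uncontract X ⊥ ≡ ⊥
  uncontract-⊥ = Empty-unique λ (v , v∈) → ∉⊥ (∈-uncontract⁻ ⊥⊆ v∈)

extendLabelling : ∀ {n k} → (Fin n → Fin k) → Fin k → Fin (suc n) → Fin k
extendLabelling f d w = lookup (tabulate f ∷ʳ d) w

extendLabelling-contractVertex : ∀ {n k} {X : Subset n} {f : Fin n → Fin k} {d} →
  (∀ {v} → v ∈ X → f v ≡ d) → ∀ v → extendLabelling f d (contractVertex X v) ≡ f v
extendLabelling-contractVertex {X = X} {f} {d} f≡d v with v ∈? X
... | yes v∈X = ≡.trans (lookup-∷ʳ-fromℕ (tabulate f) d) (≡.sym (f≡d v∈X))
... | no _    = ≡.trans (lookup-∷ʳ-inject₁ (tabulate f) d v) (lookup∘tabulate f v)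

dropLabel : ∀ {k} → Fin (suc k) → Fin k → Fin (suc k) → Fin k
dropLabel e d j with e ≟ j
... | yes _   = d
... | no e≢j = punchOut e≢j

punchIn-dropLabel : ∀ {k} {e j : Fin (suc k)} d → e ≢ j → punchIn e (dropLabel e d j) ≡ j
punchIn-dropLabel {e = e} {j} d e≢j with e ≟ j
... | yes e≡j  = contradiction e≡j e≢j
... | no e≢j′ = punchIn-punchOut e≢j′

dropLabel-punchIn : ∀ {k} (e : Fin (suc k)) d j → dropLabel e d (punchIn e j) ≡ j
dropLabel-punchIn e d j with e ≟ punchIn e j
... | yes e≡ = contradiction (≡.sym e≡) (punchInᵢ≢i e j)
... | no _   = ≡.trans (punchOut-cong e ≡.refl) (punchOut-punchIn e)

module _ (R : OrderedCommRing) where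
  open OrderedCommRing R
  open OrderedCommRingProperties R

  ∈-part⁺ : ∀ {m k} {S : Subset m} {p : Fin m → Fin k} {i v} → v ∈ S → p v ≡ i → v ∈ part R S p i
  ∈-part⁺ {p = p} {i} {v} v∈S pv≡i = x∈p∩q⁺ (v∈S , ∈-tabulate⁺ (Equivalence.to T-≡ (fromWitness pv≡i)))

  ∈-part⁻ : ∀ {m k} {S : Subset m} {p : Fin m → Fin k} {i v} → v ∈ part R S p i → v ∈ S × p v ≡ i
  ∈-part⁻ {S = S} v∈ =
    Product.map₂ (λ v∈t → toWitness (Equivalence.from T-≡ (∈-tabulate⁻ v∈t))) (x∈p∩q⁻ S _ v∈)

  part-⊆ : ∀ {m k} {S : Subset m} {p : Fin m → Fin k} {i} → part R S p i ⊆ S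
  part-⊆ = proj₁ ∘ ∈-part⁻

  part-cong : ∀ {m k} (S : Subset m) {p q : Fin m → Fin k} → p ≗ q →
              ∀ i → part R S p i ≡ part R S q i
  part-cong S p≗q i = ≡.cong (S ∩_) (tabulate-cong (λ v → ≡.cong (λ j → ⌊ j ≟ i ⌋) (p≗q v)))

  part-⊥ : ∀ {m k} (p : Fin m → Fin k) i → part R ⊥ p i ≡ ⊥
  part-⊥ p i = ∩-zeroˡ _

  ∩-part-⊆ : ∀ {m k} {S T : Subset m} (p : Fin m → Fin k) → S ⊆ T →
             ∀ i → S ∩ part R T p i ≡ part R S p i
  ∩-part-⊆ p S⊆T i = ⊆-antisym
    (λ v∈ → let (v∈S , v∈part) = x∈p∩q⁻ _ _ v∈ in ∈-part⁺ v∈S (proj₂ (∈-part⁻ {p = p} v∈part)))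
    (λ v∈ → let (v∈S , pv≡i) = ∈-part⁻ v∈ in x∈p∩q⁺ (v∈S , ∈-part⁺ (S⊆T v∈S) pv≡i))

  ⋃-part : ∀ {m k} (S : Subset m) (p : Fin m → Fin k) → ⋃ (List.tabulate (part R S p)) ≡ S
  ⋃-part S p = ⊆-antisym
    (λ v∈ → let (i , v∈part) = ∈-⋃-tabulate⁻ (part R S p) v∈ in part-⊆ {p = p} v∈part)
    (λ v∈S → ∈-⋃-tabulate⁺ (part R S p) (∈-part⁺ v∈S ≡.refl))

  part-disjoint : ∀ {m k} (S : Subset m) (p : Fin m → Fin k) {i j} → i ≢ j →
                  part R S p i ∩ part R S p j ≡ ⊥
  part-disjoint S p i≢j = disjoint⇒∩≡⊥ λ v∈i v∈j →
    i≢j (≡.trans (≡.sym (proj₂ (∈-part⁻ v∈i))) (proj₂ (∈-part⁻ v∈j)))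

  usedLabel? : ∀ {m k} (S : Subset m) (p : Fin m → Fin k) i → Dec (∃ λ v → v ∈ S × p v ≡ i)
  usedLabel? S p i = any? λ v → (v ∈? S) ×-dec (p v ≟ i)

  module _ {m k} {S : Subset m} {p : Fin m → Fin (suc k)} {e}
           (unused : ¬ ∃ λ v → v ∈ S × p v ≡ e) (d : Fin k) where

    part-unused : part R S p e ≡ ⊥
    part-unused = Empty-unique λ (v , v∈) → unused (v , ∈-part⁻ v∈)

    part-punchIn : ∀ j → part R S p (punchIn e j) ≡ part R S (dropLabel e d ∘ p) j
    part-punchIn j = ⊆-antisym
      (λ v∈ → let (v∈S , pv≡) = ∈-part⁻ v∈ in
        ∈-part⁺ v∈S (≡.trans (≡.cong (dropLabel e d) pv≡) (dropLabel-punchIn e d j)))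
      (λ {v} v∈ → let (v∈S , dpv≡j) = ∈-part⁻ v∈ in
        ∈-part⁺ v∈S (≡.trans (≡.sym (punchIn-dropLabel d (λ e≡pv → unused (v , v∈S , ≡.sym e≡pv))))
                             (≡.cong (punchIn e) dpv≡j)))

    ∑-dropLabel : (g : Subset m → Carrier) → g ⊥ ≈ 0# →
                  ∑ (g ∘ part R S p) ≈ ∑ (g ∘ part R S (dropLabel e d ∘ p))
    ∑-dropLabel g g⊥ = begin
      ∑ (g ∘ part R S p)
        ≈⟨ ∑-remove e (g ∘ part R S p) ⟩
      g (part R S p e) + ∑ (g ∘ part R S p ∘ punchIn e)
        ≈⟨ +-cong g[unused]≈0 (∑-cong λ j → ≈-cong g (part-punchIn j)) ⟩
      0# + ∑ (g ∘ part R S (dropLabel e d ∘ p))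
        ≈⟨ +-identityˡ _ ⟩
      ∑ (g ∘ part R S (dropLabel e d ∘ p)) ∎
      where
      open ≈-Reasoning
      g[unused]≈0 : g (part R S p e) ≈ 0#
      g[unused]≈0 = trans (≈-cong g part-unused) g⊥

  surjectiveRelabelling : ∀ {m} (g : Subset m → Carrier) → g ⊥ ≈ 0# → {S : Subset m} → Nonempty S →
    ∀ {k} (p : Fin m → Fin k) → ∃₂ λ k′ (r : Fin k → Fin k′) →
      IsPartitionOf R S (r ∘ p) × ∑ (g ∘ part R S p) ≈ ∑ (g ∘ part R S (r ∘ p))
  surjectiveRelabelling g g⊥ S≠∅ {zero} p = zero , id , (λ ()) , refl
  surjectiveRelabelling g g⊥ {S} (w , w∈S) {suc k} p with all? (usedLabel? S p)
  ... | yes onto = suc k , id , onto , refl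
  ... | no ¬onto with ¬∀⟶∃¬ (suc k) _ (usedLabel? S p) ¬onto
  ... | e , unused =
    let (k′ , r , onto , ∑≈) = surjectiveRelabelling g g⊥ (w , w∈S) (dropLabel e d ∘ p)
    in k′ , r ∘ dropLabel e d , onto , trans (∑-dropLabel unused d g g⊥) ∑≈
    where
    d : Fin k
    d = punchOut {i = e} {j = p w} λ e≡pw → unused (w , w∈S , ≡.sym e≡pw)

  crossing-∘ : ∀ {m k k′} (E : List (Edge m)) (r : Fin k → Fin k′) (p : Fin m → Fin k) →
               crossing R E (r ∘ p) ℕ.≤ crossing R E p
  crossing-∘ {m} E r p =
    length-mono-≤ (filter⁺ (crosses (r ∘ p)) (crosses p) (λ { ≡.refl r≢ p≡ → r≢ (≡.cong r p≡) }) (⊆-refl {x = E}))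
    where
    crosses : ∀ {k} (q : Fin m → Fin k) (e : Edge m) → Dec (q (proj₁ e) ≢ q (proj₂ e))
    crosses q (a , b) = ¬? (q a ≟ q b)

  -- Partition-connectedness only speaks about labellings onto S. Deleting unused
  -- labels removes parts equal to ⊥, worth g ⊥ ≈ 0, and cannot create crossing edges.
  partitionConnected-labelling : ∀ {m} (S : Subset m) E (g : Subset m → Carrier) →
    g ⊥ ≈ 0# → PartitionConnected R S E g →
    ∀ {k} (p : Fin m → Fin k) → ∑ (g ∘ part R S p) - g S ≤ fromℕ' (crossing R E p)
  partitionConnected-labelling S E g g⊥ connected p with nonempty? S
  ... | no S=∅ rewrite Empty-unique S=∅ = begin
    ∑ (g ∘ part R ⊥ p) - g ⊥   ≈⟨ +-cong (∑-zero λ i → trans (≈-cong g (part-⊥ p i)) g⊥) (-‿cong g⊥) ⟩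
    0# - 0#                    ≈⟨ -‿inverseʳ 0# ⟩
    0#                         ≤⟨ fromℕ'-nonneg (crossing R E p) ⟩
    fromℕ' (crossing R E p)    ∎
    where open ≤-Reasoning
  ... | yes S≠∅ with surjectiveRelabelling g g⊥ S≠∅ p
  ... | k′ , r , onto , ∑≈ = begin
    ∑ (g ∘ part R S p) - g S          ≈⟨ +-congʳ ∑≈ ⟩
    ∑ (g ∘ part R S (r ∘ p)) - g S    ≤⟨ connected k′ (r ∘ p) onto ⟩
    fromℕ' (crossing R E (r ∘ p))     ≤⟨ fromℕ'-mono-≤ (crossing-∘ E r p) ⟩
    fromℕ' (crossing R E p)           ∎
    where open ≤-Reasoning

  uncontract-part : ∀ {n k} {X : Subset n} (Q : Fin (suc n) → Fin k) j →
                    uncontract X (part R (contractV X) Q j) ≡ part R ⊤ (Q ∘ contractVertex X) j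
  uncontract-part {X = X} Q j = ⊆-antisym
    (λ v∈ → ∈-part⁺ {p = Q ∘ contractVertex X} ∈⊤
              (proj₂ (∈-part⁻ {p = Q} (∈-uncontract⁻ {X = X} (part-⊆ {p = Q}) v∈))))
    (λ {v} v∈ → ∈-uncontract⁺ {X = X}
                  (∈-part⁺ {p = Q} (contractVertex-∈-contractV v) (proj₂ (∈-part⁻ v∈))))

  contracted-labelling : ∀ {n} (X : Subset n) (E : List (Edge n)) (l : Subset n → Carrier) →
    l ⊥ ≈ 0# → PartitionConnected R (contractV X) (contractE X E) (contractL X l) →
    ∀ {k} (f : Fin n → Fin k) d → (∀ {v} → v ∈ X → f v ≡ d) →
    ∑ (l ∘ part R ⊤ f) - l ⊤ ≤ fromℕ' (crossing R (contractE X E) (extendLabelling f d))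
  contracted-labelling {n} X E l l⊥ connected {k} f d f≡d = begin
    ∑ (l ∘ part R ⊤ f) - l ⊤
      ≈⟨ +-cong (∑-cong λ j → ≈-cong l (≡.sym (uncontract-part-Q j)))
                (-‿cong (≈-cong l (≡.sym (uncontract-contractV {X = X})))) ⟩
    ∑ (contractL X l ∘ part R (contractV X) Q) - contractL X l (contractV X)
      ≤⟨ partitionConnected-labelling (contractV X) (contractE X E) (contractL X l)
           (trans (≈-cong l (uncontract-⊥ {X = X})) l⊥) connected Q ⟩
    fromℕ' (crossing R (contractE X E) Q) ∎
    where
    open ≤-Reasoning
    Q : Fin (suc n) → Fin k
    Q = extendLabelling f d
    uncontract-part-Q : ∀ j → uncontract X (part R (contractV X) Q j) ≡ part R ⊤ f j
    uncontract-part-Q j = ≡.trans (uncontract-part Q j) (part-cong ⊤ (extendLabelling-contractVertex f≡d) j)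

  crossing-induced+contracted : ∀ {n k k′} (X : Subset n) (E : List (Edge n))
    (p : Fin n → Fin k) (Q : Fin (suc n) → Fin k′) (f : Fin k → Fin k′) →
    (∀ v → Q (contractVertex X v) ≡ f (p v)) →
    crossing R (inducedE X E) p ℕ.+ crossing R (contractE X E) Q ℕ.≤ crossing R E p
  crossing-induced+contracted X []             p Q f Q∘cv≗f∘p = z≤n
  crossing-induced+contracted X ((a , b) ∷ E) p Q f Q∘cv≗f∘p
    with crossing-induced+contracted X E p Q f Q∘cv≗f∘p | inside X (a , b)
  ... | rest | true with p a ≟ p b
  ...   | yes _ = rest
  ...   | no _  = s≤s rest
  crossing-induced+contracted X ((a , b) ∷ E) p Q f Q∘cv≗f∘p | rest | false
    with Q (contractVertex X a) ≟ Q (contractVertex X b) | p a ≟ p b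
  ...   | yes _    | yes _     = rest
  ...   | yes _    | no _      = ℕ.m≤n⇒m≤1+n rest
  ...   | no Qa≢Qb | yes pa≡pb = contradiction Qa≡Qb Qa≢Qb
    where
    Qa≡Qb : Q (contractVertex X a) ≡ Q (contractVertex X b)
    Qa≡Qb = ≡.trans (Q∘cv≗f∘p a) (≡.trans (≡.cong f pa≡pb) (≡.sym (Q∘cv≗f∘p b)))
  ...   | no _     | no _      = ≡.subst (ℕ._≤ suc (crossing R E p)) (≡.sym (ℕ.+-suc _ _)) (s≤s rest)

  module _ {n} {l : Subset n → Carrier} (l⊥ : l ⊥ ≈ 0#)
           (supermodular : IntersectingSupermodular R l) where

    supermodular-or-empty : ∀ {T B} → Nonempty (T ∩ B) ⊎ B ≡ ⊥ → l T + l B ≤ l (T ∩ B) + l (T ∪ B)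
    supermodular-or-empty (inj₁ T∩B≠∅) = supermodular _ _ T∩B≠∅
    supermodular-or-empty {T} (inj₂ ≡.refl) = ≤-reflexive (begin
      l T + l ⊥                ≈⟨ +-comm (l T) (l ⊥) ⟩
      l ⊥ + l T                ≈⟨ +-cong (≈-cong l (≡.sym (∩-zeroʳ T)))
                                          (≈-cong l (≡.sym (∪-identityʳ T))) ⟩
      l (T ∩ ⊥) + l (T ∪ ⊥)    ∎)
      where open ≈-Reasoning

    uncross : ∀ {k} T (B : Fin k → Subset n) → (∀ {i j} → i ≢ j → B i ∩ B j ≡ ⊥) →
      (∀ i → Nonempty (T ∩ B i) ⊎ B i ≡ ⊥) →
      l T + ∑ (l ∘ B) ≤ ∑ (λ i → l (T ∩ B i)) + l (T ∪ ⋃ (List.tabulate B))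
    uncross {zero} T B _ _ = ≤-reflexive (begin
      l T + 0#         ≈⟨ +-comm (l T) 0# ⟩
      0# + l T         ≈⟨ +-congˡ (≈-cong l (≡.sym (∪-identityʳ T))) ⟩
      0# + l (T ∪ ⊥)   ∎)
      where open ≈-Reasoning
    uncross {suc k} T B disjoint meets = begin
      l T + (l (B zero) + ∑ (l ∘ B ∘ suc))
        ≈⟨ +-assoc _ _ _ ⟨
      (l T + l (B zero)) + ∑ (l ∘ B ∘ suc)
        ≤⟨ +-monoˡ-≤ _ (supermodular-or-empty (meets zero)) ⟩
      (l (T ∩ B zero) + l T′) + ∑ (l ∘ B ∘ suc)
        ≈⟨ +-assoc _ _ _ ⟩
      l (T ∩ B zero) + (l T′ + ∑ (l ∘ B ∘ suc))
        ≤⟨ +-monoʳ-≤ _ (uncross T′ (B ∘ suc) (λ i≢j → disjoint (i≢j ∘ suc-injective)) meets′) ⟩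
      l (T ∩ B zero) + (∑ (λ i → l (T′ ∩ B (suc i))) + l (T′ ∪ ⋃ (List.tabulate (B ∘ suc))))
        ≈⟨ +-congˡ (+-cong (∑-cong λ i → ≈-cong l (T′∩B i))
                           (≈-cong l (∪-assoc T (B zero) _))) ⟩
      l (T ∩ B zero) + (∑ (λ i → l (T ∩ B (suc i))) + l (T ∪ ⋃ (List.tabulate B)))
        ≈⟨ +-assoc _ _ _ ⟨
      ∑ (λ i → l (T ∩ B i)) + l (T ∪ ⋃ (List.tabulate B)) ∎
      where
      open ≤-Reasoning
      T′ : Subset n
      T′ = T ∪ B zero
      T′∩B : ∀ i → T′ ∩ B (suc i) ≡ T ∩ B (suc i)
      T′∩B i = ≡.trans (∩-distribʳ-∪ (B (suc i)) T (B zero))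
               (≡.trans (≡.cong (T ∩ B (suc i) ∪_) (disjoint (λ ()))) (∪-identityʳ _))
      meets′ : ∀ i → Nonempty (T′ ∩ B (suc i)) ⊎ B (suc i) ≡ ⊥
      meets′ i rewrite T′∩B i = meets (suc i)

  -- M is the block of the contracted vertex in the partition of G/X induced by p.
  module MergedBlock {n k} (X : Subset n) (p : Fin n → Fin k) where

    meets : Fin k → Bool
    meets i = ⌊ nonempty? (part R X p i) ⌋

    merge : Fin k → Fin (suc k)
    merge i = if meets i then zero else suc i

    M : Subset n
    M = part R ⊤ (merge ∘ p) zero

    avoiding : Fin k → Subset n
    avoiding i = part R ⊤ (merge ∘ p) (suc i)

    meets⇒nonempty : ∀ {i} → meets i ≡ true → Nonempty (part R X p i)
    meets⇒nonempty met = toWitness (Equivalence.from T-≡ met)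

    merge-met : ∀ {i} → meets i ≡ true → merge i ≡ zero
    merge-met {i} met with meets i
    merge-met ≡.refl | true = ≡.refl

    merge-unmet : ∀ {i} → meets i ≡ false → merge i ≡ suc i
    merge-unmet {i} unmet with meets i
    merge-unmet ≡.refl | false = ≡.refl

    merge≡zero : ∀ {i} → merge i ≡ zero → meets i ≡ true
    merge≡zero {i} _ with meets i
    merge≡zero _ | true = ≡.refl
    merge≡zero () | false

    merge≡suc : ∀ {i j} → merge i ≡ suc j → meets i ≡ false × i ≡ j
    merge≡suc {i} _ with meets i
    merge≡suc () | true
    merge≡suc ≡.refl | false = ≡.refl , ≡.refl

    merge-∈ : ∀ {v} → v ∈ X → merge (p v) ≡ zero
    merge-∈ v∈X = merge-met (Equivalence.to T-≡ (fromWitness (_ , ∈-part⁺ v∈X ≡.refl)))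

    X⊆M : X ⊆ M
    X⊆M v∈X = ∈-part⁺ ∈⊤ (merge-∈ v∈X)

    ∈M⇒meets : ∀ {v} → v ∈ M → meets (p v) ≡ true
    ∈M⇒meets v∈M = merge≡zero (proj₂ (∈-part⁻ v∈M))

    part-M-met : ∀ {i} → meets i ≡ true → part R M p i ≡ part R ⊤ p i
    part-M-met met = ⊆-antisym
      (λ v∈ → ∈-part⁺ ∈⊤ (proj₂ (∈-part⁻ {p = p} v∈)))
      (λ v∈ → let pv≡i = proj₂ (∈-part⁻ v∈) in
        ∈-part⁺ (∈-part⁺ ∈⊤ (≡.trans (≡.cong merge pv≡i) (merge-met met))) pv≡i)

    part-M-unmet : ∀ {i} → meets i ≡ false → part R M p i ≡ ⊥
    part-M-unmet unmet = Empty-unique λ (v , v∈) → let (v∈M , pv≡i) = ∈-part⁻ v∈ in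
      contradiction (≡.trans (≡.sym unmet) (≡.subst (λ j → meets j ≡ true) pv≡i (∈M⇒meets v∈M))) λ ()

    avoiding-met : ∀ {i} → meets i ≡ true → avoiding i ≡ ⊥
    avoiding-met met = Empty-unique λ (v , v∈) → let (unmet , pv≡i) = merge≡suc (proj₂ (∈-part⁻ v∈)) in
      contradiction (≡.trans (≡.sym met) (≡.subst (λ j → meets j ≡ false) pv≡i unmet)) λ ()

    avoiding-unmet : ∀ {i} → meets i ≡ false → avoiding i ≡ part R ⊤ p i
    avoiding-unmet unmet = ⊆-antisym
      (λ v∈ → ∈-part⁺ ∈⊤ (proj₂ (merge≡suc (proj₂ (∈-part⁻ {p = merge ∘ p} v∈)))))
      (λ v∈ → ∈-part⁺ ∈⊤ (≡.trans (≡.cong merge (proj₂ (∈-part⁻ {p = p} v∈))) (merge-unmet unmet)))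

    meeting-or-empty : ∀ i → Nonempty (X ∩ part R M p i) ⊎ part R M p i ≡ ⊥
    meeting-or-empty i with meets i in met
    ... | true  = inj₁ (≡.subst Nonempty (≡.sym (∩-part-⊆ p X⊆M i)) (meets⇒nonempty met))
    ... | false = inj₂ (part-M-unmet met)

    module _ (l : Subset n → Carrier) (l⊥ : l ⊥ ≈ 0#) where

      l-split : ∀ i → l (part R ⊤ p i) ≈ l (part R M p i) + l (avoiding i)
      l-split i with meets i in met
      ... | true  = begin
        l (part R ⊤ p i)                ≈⟨ +-identityʳ _ ⟨
        l (part R ⊤ p i) + 0#           ≈⟨ +-cong (≈-cong l (≡.sym (part-M-met met)))
                                                  (trans (sym l⊥) (≈-cong l (≡.sym (avoiding-met met)))) ⟩
        l (part R M p i) + l (avoiding i) ∎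
        where open ≈-Reasoning
      ... | false = begin
        l (part R ⊤ p i)                ≈⟨ +-identityˡ _ ⟨
        0# + l (part R ⊤ p i)           ≈⟨ +-cong (trans (sym l⊥) (≈-cong l (≡.sym (part-M-unmet met))))
                                                  (≈-cong l (≡.sym (avoiding-unmet met))) ⟩
        l (part R M p i) + l (avoiding i) ∎
        where open ≈-Reasoning

      uncross-merged : IntersectingSupermodular R l → l X + ∑ (l ∘ part R M p) ≤ ∑ (l ∘ part R X p) + l M
      uncross-merged supermodular = begin
        l X + ∑ (l ∘ part R M p)
          ≤⟨ uncross l⊥ supermodular X (part R M p) (part-disjoint M p) meeting-or-empty ⟩
        ∑ (λ i → l (X ∩ part R M p i)) + l (X ∪ ⋃ (List.tabulate (part R M p)))
          ≈⟨ +-cong (∑-cong λ i → ≈-cong l (∩-part-⊆ p X⊆M i))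
                    (≈-cong l (≡.trans (≡.cong (X ∪_) (⋃-part M p)) X∪M≡M)) ⟩
        ∑ (l ∘ part R X p) + l M ∎
        where
        open ≤-Reasoning
        X∪M≡M : X ∪ M ≡ M
        X∪M≡M = ⊆-antisym (λ v∈ → [ X⊆M , id ]′ (x∈p∪q⁻ X M v∈)) (q⊆p∪q X M)

mainTheorem15 : (R : OrderedCommRing) (n : ℕ) (E : List (Edge n)) (X : Subset n)
    (l : Subset n → OrderedCommRing.Carrier R) →
    Loopless E →
    OrderedCommRing._≈_ R (l ⊥) (OrderedCommRing.0# R) →
    IntersectingSupermodular R l →
    PartitionConnected R X (inducedE X E) l →
    PartitionConnected R (contractV X) (contractE X E) (contractL X l) →
    PartitionConnected R ⊤ E l
mainTheorem15 R n E X l _ l⊥ supermodular insideConnected contractedConnected k p _ = begin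
  ∑ (l ∘ part R ⊤ p) - l ⊤
    ≈⟨ +-congʳ (trans (∑-cong (l-split l l⊥)) (∑-+ (l ∘ part R M p) (l ∘ avoiding))) ⟩
  (∑ (l ∘ part R M p) + ∑ (l ∘ avoiding)) - l ⊤
    ≈⟨ +-assoc _ _ _ ⟩
  ∑ (l ∘ part R M p) + (∑ (l ∘ avoiding) - l ⊤)
    ≤⟨ +-monoˡ-≤ _ (x+y≤z+w⇒y≤z-x+w (uncross-merged l l⊥ supermodular)) ⟩
  ((∑ (l ∘ part R X p) - l X) + l M) + (∑ (l ∘ avoiding) - l ⊤)
    ≈⟨ trans (+-assoc _ _ _) (+-congˡ (sym (+-assoc _ _ _))) ⟩
  (∑ (l ∘ part R X p) - l X) + ((l M + ∑ (l ∘ avoiding)) - l ⊤)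
    ≤⟨ +-mono-≤ (partitionConnected-labelling R X (inducedE X E) l l⊥ insideConnected p)
                (contracted-labelling R X E l l⊥ contractedConnected (merge ∘ p) zero merge-∈) ⟩
  fromℕ' (crossing R (inducedE X E) p) + fromℕ' (crossing R (contractE X E) Q)
    ≈⟨ fromℕ'-homo-+ (crossing R (inducedE X E) p) (crossing R (contractE X E) Q) ⟨
  fromℕ' (crossing R (inducedE X E) p ℕ.+ crossing R (contractE X E) Q)
    ≤⟨ fromℕ'-mono-≤ (crossing-induced+contracted R X E p Q merge
                                                   (extendLabelling-contractVertex merge-∈)) ⟩
  fromℕ' (crossing R E p) ∎
  where
  open OrderedCommRing R
  open OrderedCommRingProperties R
  open ≤-Reasoning
  open MergedBlock R X p
  Q : Fin (suc n) → Fin (suc k)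
  Q = extendLabelling (merge ∘ p) zero
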